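{- For $j\in\mathbb{Z}$ let $S_j=S_{j,j\pm1}(z,u_0,u_1)=\sum_B z^{|B|}u_0^{A_j(B)}u_1^{C_j(B)}$, the sum over all naturally embedded ternary trees $B$, where $|B|$ is the number of internal nodes, $A_j(B)$ the number of internal nodes with label $j$, and $C_j(B)$ the number of internal nodes with label in $\{j-1,j+1\}$. Then $S_{j,j\pm1}(z,u_0,u_1)=S_{ -j,-j\pm1}(z,u_0,u_1)$ for all $j\in\mathbb{Z}$, and the $S_j$ are determined by the system $$S_j=1+zS_{j-1}S_jS_{j+1}\ (j\ge2),\qquad S_1=1+u_1zS_0S_1S_2,\qquad S_0=1+u_0zS_{ -1}S_0S_1=1+u_0zS_0S_1^2.$$
   Context: A ternary tree is either an external node or an internal node with three ordered subtrees (left, center, right). In the natural embedding the root has label $0$ and the left, center, right children of a node with label $j$ have labels $j-1,j,j+1$. -}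

module Defs where

open import Data.Nat using (ℕ; zero; suc) renaming (_+_ to _+ℕ_; _∸_ to _∸_)
open import Data.Integer using (ℤ; +_; -_; _+_; _-_; _*_; 0ℤ; 1ℤ)
import Data.Integer as ℤ
open import Data.Bool using (Bool; true; false; if_then_else_; _∨_)
open import Data.Product using (Σ; _×_)
open import Data.Fin using (Fin)
open import Function.Bundles using (_↔_)
open import Relation.Nullary using (does)
open import Relation.Binary.PropositionalEquality using (_≡_)

data Tree : Set where
  leaf : Tree
  node : Tree → Tree → Tree → Tree

size : Tree → ℕ
size leaf = 0
size (node l c r) = suc (size l +ℕ size c +ℕ size r)

-- Natural embedding: a node with label ℓ has children labelled ℓ-1, ℓ, ℓ+1.
-- cntIf p ℓ B : number of internal nodes of B (whose root has label ℓ) with label satisfying p.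
cntIf : (ℤ → Bool) → ℤ → Tree → ℕ
cntIf p ℓ leaf = 0
cntIf p ℓ (node l c r) =
  (if p ℓ then 1 else 0) +ℕ cntIf p (ℓ - 1ℤ) l +ℕ cntIf p ℓ c +ℕ cntIf p (ℓ + 1ℤ) r

A : ℤ → Tree → ℕ
A j B = cntIf (λ ℓ → does (ℓ ℤ.≟ j)) 0ℤ B

C : ℤ → Tree → ℕ
C j B = cntIf (λ ℓ → does (ℓ ℤ.≟ (j - 1ℤ)) ∨ does (ℓ ℤ.≟ (j + 1ℤ))) 0ℤ B

-- Formal power series in z, u0, u1 with integer coefficients:
-- F n a c is the coefficient of z^n u0^a u1^c.
Series : Set
Series = ℕ → ℕ → ℕ → ℤ

_≋_ : Series → Series → Set
F ≋ G = ∀ n a c → F n a c ≡ G n a c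
infix 4 _≋_

sumTo : ℕ → (ℕ → ℤ) → ℤ
sumTo zero f = f 0
sumTo (suc n) f = sumTo n f + f (suc n)

𝟙 : Series
𝟙 zero zero zero = 1ℤ
𝟙 _ _ _ = 0ℤ

_⊕_ : Series → Series → Series
(F ⊕ G) n a c = F n a c + G n a c
infixl 6 _⊕_

_⊛_ : Series → Series → Series
(F ⊛ G) n a c =
  sumTo n (λ i → sumTo a (λ p → sumTo c (λ q →
    F i p q * G (n ∸ i) (a ∸ p) (c ∸ q))))
infixl 7 _⊛_

z· : Series → Series
z· F zero a c = 0ℤ
z· F (suc n) a c = F n a c

u0· : Series → Series
u0· F n zero c = 0ℤ
u0· F n (suc a) c = F n a c

u1· : Series → Series
u1· F n a zero = 0ℤ
u1· F n a (suc c) = F n a c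

-- F is S_j = Σ_B z^{|B|} u0^{A_j(B)} u1^{C_j(B)}: every coefficient is the
-- number of trees with the corresponding statistics (a finite count m).
IsGF : ℤ → Series → Set
IsGF j F = ∀ n a c → Σ ℕ λ m → (F n a c ≡ + m) ×
  (Fin m ↔ Σ Tree (λ B → (size B ≡ n) × (A j B ≡ a) × (C j B ≡ c)))

-- The system for j ≥ 0 (with S_{-1} replaced by S_1), for an ℕ-indexed family.
SolvesSystem : (ℕ → Series) → Set
SolvesSystem T =
  (∀ k → T (suc (suc k)) ≋ 𝟙 ⊕ z· (T (suc k) ⊛ T (suc (suc k)) ⊛ T (suc (suc (suc k))))) ×
  (T 1 ≋ 𝟙 ⊕ u1· (z· (T 0 ⊛ T 1 ⊛ T 2))) ×
  (T 0 ≋ 𝟙 ⊕ u0· (z· (T 0 ⊛ T 1 ⊛ T 1)))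

-- S_j is the counting series of the trees with given (|B|, A_j(B), C_j(B)); these sets are finite
-- because a tree with n internal nodes has height at most n. Cutting a tree at its root identifies
-- it with a leaf or a triple of subtrees. Seen from their own roots, the left subtree is counted by
-- A_{j+1}, C_{j+1}, the center one by A_j, C_j and the right one by A_{j-1}, C_{j-1}, while the root
-- itself contributes u0 exactly when j = 0 and u1 exactly when j = ±1; this is the system. Mirroring
-- a tree (swapping left and right subtrees everywhere) negates all labels, so S_j = S_{-j}, which
-- turns S_{-1} into S_1 in the equation for S_0. Finally the system expresses the coefficients of
-- z^n through those of lower degree, so it has only one solution.
module Submission where

open import Defs
open import Data.Nat using (ℕ; suc)
open import Data.Integer using (ℤ; +_; -_; _+_; _-_; 1ℤ; _≤_)
open import Data.Product using (Σ; _×_)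

open import Data.Bool using (Bool; if_then_else_; _∨_)
import Data.Bool.Properties as BoolP
open import Data.Empty using (⊥-elim)
open import Data.Fin as Fin using (Fin)
open import Data.Fin.Permutation using (↔⇒≡)
import Data.Fin.Properties as FinP
open import Data.Integer as ℤ using (0ℤ; _≟_; +≤+)
import Data.Integer.Properties as ℤP
open import Data.Integer.Tactic.RingSolver using (solve-∀)
open import Data.Nat as ℕ using (zero; _≤′_; ≤′-refl; ≤′-step; z≤n; s≤s)
import Data.Nat.Properties as ℕP
import Data.Nat.Tactic.RingSolver as ℕSolver
open import Data.Product using (_,_; proj₁; proj₂)
open import Data.Product.Function.Dependent.Propositional using (Σ-↔)
open import Data.Product.Function.NonDependent.Propositional using (_×-↔_)
open import Data.Sum using (_⊎_; inj₁; inj₂)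
open import Data.Sum.Function.Propositional using (_⊎-↔_)
open import Data.Unit using (⊤; tt)
open import Function.Bundles using (_↔_; Inverse; mk↔ₛ′; mk⇔)
open import Function.Properties.Inverse using (↔-refl; ↔-sym; ↔-trans)
open import Function.Related.TypeIsomorphisms using (Σ-distribʳ-⊎)
open import Relation.Nullary using (¬_; Dec; yes; no; does; Irrelevant)
open import Relation.Nullary.Decidable using (does-⇔; _×-dec_)
open import Relation.Binary.PropositionalEquality

HasCard : ℤ → Set → Set
HasCard k X = Σ ℕ λ m → (k ≡ + m) × (Fin m ↔ X)

module _ {X Y : Set} where

  HasCard-↔ : ∀ {k} → HasCard k X → X ↔ Y → HasCard k Y
  HasCard-↔ (m , k≡m , φ) ψ = m , k≡m , ↔-trans φ ψ

  HasCard-⊎ : ∀ {k k′} → HasCard k X → HasCard k′ Y → HasCard (k + k′) (X ⊎ Y)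
  HasCard-⊎ (m , refl , φ) (m′ , refl , φ′) =
    m ℕ.+ m′ , sym (ℤP.pos-+ m m′) , ↔-trans FinP.+↔⊎ (φ ⊎-↔ φ′)

  HasCard-× : ∀ {k k′} → HasCard k X → HasCard k′ Y → HasCard (k ℤ.* k′) (X × Y)
  HasCard-× (m , refl , φ) (m′ , refl , φ′) =
    m ℕ.* m′ , sym (ℤP.pos-* m m′) , ↔-trans FinP.*↔× (φ ×-↔ φ′)

module _ {X : Set} where

  HasCard-unique : ∀ {k k′} → HasCard k X → HasCard k′ X → k ≡ k′
  HasCard-unique (m , refl , φ) (m′ , refl , φ′) = cong +_ (↔⇒≡ (↔-trans φ (↔-sym φ′)))

  HasCard-0 : ¬ X → HasCard 0ℤ X
  HasCard-0 ¬x = 0 , refl , mk↔ₛ′ (λ ()) (λ x → ⊥-elim (¬x x)) (λ x → ⊥-elim (¬x x)) (λ ())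

  HasCard-1 : (x : X) → (∀ y → y ≡ x) → HasCard 1ℤ X
  HasCard-1 x ≡x = 1 , refl ,
    mk↔ₛ′ (λ _ → x) (λ _ → Fin.zero) (λ y → sym (≡x y)) (λ { Fin.zero → refl ; (Fin.suc ()) })

≤′-irrelevant : ∀ {m n} → Irrelevant (m ≤′ n)
≤′-irrelevant ≤′-refl ≤′-refl = refl
≤′-irrelevant ≤′-refl (≤′-step q) = ⊥-elim (ℕP.<-irrefl refl (ℕP.≤′⇒≤ q))
≤′-irrelevant (≤′-step p) ≤′-refl = ⊥-elim (ℕP.<-irrefl refl (ℕP.≤′⇒≤ p))
≤′-irrelevant (≤′-step p) (≤′-step q) = cong ≤′-step (≤′-irrelevant p q)

-- Bounded by _≤′_ so that splitting off the top index is a pattern match.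
Σ≤ : ℕ → (ℕ → Set) → Set
Σ≤ n T = Σ ℕ λ i → i ≤′ n × T i

module _ {T : ℕ → Set} where

  Σ≤-zero : Σ≤ zero T ↔ T zero
  Σ≤-zero = mk↔ₛ′ (λ { (_ , ≤′-refl , t) → t }) (λ t → zero , ≤′-refl , t)
                  (λ _ → refl) (λ { (_ , ≤′-refl , _) → refl })

  Σ≤-suc : ∀ {n} → Σ≤ (suc n) T ↔ (Σ≤ n T ⊎ T (suc n))
  Σ≤-suc {n} = mk↔ₛ′ split join
    (λ { (inj₁ _) → refl ; (inj₂ _) → refl })
    (λ { (_ , ≤′-refl , _) → refl ; (_ , ≤′-step _ , _) → refl })
    where
    split : Σ≤ (suc n) T → Σ≤ n T ⊎ T (suc n)
    split (_ , ≤′-refl , t) = inj₂ t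
    split (i , ≤′-step i≤n , t) = inj₁ (i , i≤n , t)
    join : Σ≤ n T ⊎ T (suc n) → Σ≤ (suc n) T
    join (inj₁ (i , i≤n , t)) = i , ≤′-step i≤n , t
    join (inj₂ t) = suc n , ≤′-refl , t

HasCard-Σ≤ : ∀ n {g : ℕ → ℤ} {T : ℕ → Set} → (∀ i → HasCard (g i) (T i)) →
  HasCard (sumTo n g) (Σ≤ n T)
HasCard-Σ≤ zero card = HasCard-↔ (card 0) (↔-sym Σ≤-zero)
HasCard-Σ≤ (suc n) card = HasCard-↔ (HasCard-⊎ (HasCard-Σ≤ n card) (card (suc n))) (↔-sym Σ≤-suc)

Finite : Set → Set
Finite X = Σ ℤ λ k → HasCard k X

module _ {X Y : Set} where

  Finite-↔ : Finite X → X ↔ Y → Finite Y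
  Finite-↔ (k , card) φ = k , HasCard-↔ card φ

  Finite-⊎ : Finite X → Finite Y → Finite (X ⊎ Y)
  Finite-⊎ (k , card) (k′ , card′) = k + k′ , HasCard-⊎ card card′

  Finite-× : Finite X → Finite Y → Finite (X × Y)
  Finite-× (k , card) (k′ , card′) = k ℤ.* k′ , HasCard-× card card′

Finite-⊤ : Finite ⊤
Finite-⊤ = 1ℤ , HasCard-1 tt (λ _ → refl)

×-irrelevant : ∀ {P Q : Set} → Irrelevant P → Irrelevant Q → Irrelevant (P × Q)
×-irrelevant irrP irrQ (p , q) (p′ , q′) = cong₂ _,_ (irrP p p′) (irrQ q q′)

Finite-prop : ∀ {P : Set} → Dec P → Irrelevant P → Finite P
Finite-prop (yes p) irr = 1ℤ , HasCard-1 p (λ q → irr q p)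
Finite-prop (no ¬p) _ = 0ℤ , HasCard-0 ¬p

Σ-Fin-suc : ∀ {m} {P : Fin (suc m) → Set} →
  Σ (Fin (suc m)) P ↔ (P Fin.zero ⊎ Σ (Fin m) (λ i → P (Fin.suc i)))
Σ-Fin-suc {m} {P} = mk↔ₛ′ split join
  (λ { (inj₁ _) → refl ; (inj₂ _) → refl })
  (λ { (Fin.zero , _) → refl ; (Fin.suc _ , _) → refl })
  where
  split : Σ (Fin (suc m)) P → P Fin.zero ⊎ Σ (Fin m) (λ i → P (Fin.suc i))
  split (Fin.zero , p) = inj₁ p
  split (Fin.suc i , p) = inj₂ (i , p)
  join : P Fin.zero ⊎ Σ (Fin m) (λ i → P (Fin.suc i)) → Σ (Fin (suc m)) P
  join (inj₁ p) = Fin.zero , p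
  join (inj₂ (i , p)) = Fin.suc i , p

Finite-Σ-Fin : ∀ m {P : Fin m → Set} → (∀ i → Finite (P i)) → Finite (Σ (Fin m) P)
Finite-Σ-Fin zero _ = 0ℤ , HasCard-0 (λ { (() , _) })
Finite-Σ-Fin (suc m) fin =
  Finite-↔ (Finite-⊎ (fin Fin.zero) (Finite-Σ-Fin m (λ i → fin (Fin.suc i)))) (↔-sym Σ-Fin-suc)

Finite-Σ : ∀ {X : Set} {P : X → Set} → Finite X → (∀ x → Finite (P x)) → Finite (Σ X P)
Finite-Σ (_ , m , _ , φ) fin =
  Finite-↔ (Finite-Σ-Fin m (λ i → fin (Inverse.to φ i))) (Σ-↔ φ ↔-refl)

record Class : Set₁ where
  field
    Carrier : Set
    zdeg u0deg u1deg : Carrier → ℕ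
open Class

Fiber : Class → ℕ → ℕ → ℕ → Set
Fiber K n a c = Σ (Carrier K) λ x → (zdeg K x ≡ n) × (u0deg K x ≡ a) × (u1deg K x ≡ c)

IsGFOf : Series → Class → Set
IsGFOf G K = ∀ n a c → HasCard (G n a c) (Fiber K n a c)

IsGFOf-unique : ∀ {F G K} → IsGFOf F K → IsGFOf G K → F ≋ G
IsGFOf-unique F-K G-K n a c = HasCard-unique (F-K n a c) (G-K n a c)

𝟙C : Class
𝟙C = record { Carrier = ⊤ ; zdeg = λ _ → 0 ; u0deg = λ _ → 0 ; u1deg = λ _ → 0 }

_⊎C_ : Class → Class → Class
K ⊎C L = record
  { Carrier = Carrier K ⊎ Carrier L
  ; zdeg  = λ { (inj₁ x) → zdeg K x  ; (inj₂ y) → zdeg L y }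
  ; u0deg = λ { (inj₁ x) → u0deg K x ; (inj₂ y) → u0deg L y }
  ; u1deg = λ { (inj₁ x) → u1deg K x ; (inj₂ y) → u1deg L y }
  }

_×C_ : Class → Class → Class
K ×C L = record
  { Carrier = Carrier K × Carrier L
  ; zdeg  = λ (x , y) → zdeg K x ℕ.+ zdeg L y
  ; u0deg = λ (x , y) → u0deg K x ℕ.+ u0deg L y
  ; u1deg = λ (x , y) → u1deg K x ℕ.+ u1deg L y
  }

shift : ℕ → ℕ → ℕ → Class → Class
shift dn da dc K = record
  { Carrier = Carrier K
  ; zdeg  = λ x → dn ℕ.+ zdeg K x
  ; u0deg = λ x → da ℕ.+ u0deg K x
  ; u1deg = λ x → dc ℕ.+ u1deg K x
  }

IsGFOf-𝟙 : IsGFOf 𝟙 𝟙C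
IsGFOf-𝟙 zero zero zero = HasCard-1 (tt , refl , refl , refl) (λ { (tt , refl , refl , refl) → refl })
IsGFOf-𝟙 zero zero (suc c) = HasCard-0 λ { (_ , _ , _ , ()) }
IsGFOf-𝟙 zero (suc a) c = HasCard-0 λ { (_ , _ , () , _) }
IsGFOf-𝟙 (suc n) a c = HasCard-0 λ { (_ , () , _) }

IsGFOf-⊕ : ∀ {F G K L} → IsGFOf F K → IsGFOf G L → IsGFOf (F ⊕ G) (K ⊎C L)
IsGFOf-⊕ F-K G-L n a c = HasCard-↔ (HasCard-⊎ (F-K n a c) (G-L n a c)) (↔-sym Σ-distribʳ-⊎)

suc≡suc-↔ : ∀ {m n} → (suc m ≡ suc n) ↔ (m ≡ n)
suc≡suc-↔ = mk↔ₛ′ ℕP.suc-injective (cong suc) (λ _ → ℕP.≡-irrelevant _ _) (λ _ → ℕP.≡-irrelevant _ _)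

IsGFOf-z : ∀ {G K} → IsGFOf G K → IsGFOf (z· G) (shift 1 0 0 K)
IsGFOf-z G-K zero a c = HasCard-0 λ { (_ , () , _) }
IsGFOf-z G-K (suc n) a c = HasCard-↔ (G-K n a c) (Σ-↔ ↔-refl (↔-sym suc≡suc-↔ ×-↔ ↔-refl))

IsGFOf-u0 : ∀ {G K} → IsGFOf G K → IsGFOf (u0· G) (shift 0 1 0 K)
IsGFOf-u0 G-K n zero c = HasCard-0 λ { (_ , _ , () , _) }
IsGFOf-u0 G-K n (suc a) c =
  HasCard-↔ (G-K n a c) (Σ-↔ ↔-refl (↔-refl ×-↔ ↔-sym suc≡suc-↔ ×-↔ ↔-refl))

IsGFOf-u1 : ∀ {G K} → IsGFOf G K → IsGFOf (u1· G) (shift 0 0 1 K)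
IsGFOf-u1 G-K n a zero = HasCard-0 λ { (_ , _ , _ , ()) }
IsGFOf-u1 G-K n a (suc c) =
  HasCard-↔ (G-K n a c) (Σ-↔ ↔-refl (↔-refl ×-↔ ↔-refl ×-↔ ↔-sym suc≡suc-↔))

+≡-↔ : ∀ {u v n} → (u ℕ.+ v ≡ n) ↔ (Σ≤ n λ i → (u ≡ i) × (v ≡ n ℕ.∸ i))
+≡-↔ {u} {v} {n} = mk↔ₛ′ split join
  (λ { (_ , _ , refl , _) → cong₂ (λ p q → u , p , refl , q) (≤′-irrelevant _ _) (ℕP.≡-irrelevant _ _) })
  (λ _ → ℕP.≡-irrelevant _ _)
  where
  split : u ℕ.+ v ≡ n → Σ≤ n λ i → (u ≡ i) × (v ≡ n ℕ.∸ i)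
  split u+v≡n = u , ℕP.≤⇒≤′ (subst (u ℕ.≤_) u+v≡n (ℕP.m≤m+n u v)) , refl
              , trans (sym (ℕP.m+n∸m≡n u v)) (cong (ℕ._∸ u) u+v≡n)
  join : (Σ≤ n λ i → (u ≡ i) × (v ≡ n ℕ.∸ i)) → u ℕ.+ v ≡ n
  join (i , i≤n , u≡i , v≡n∸i) = trans (cong₂ ℕ._+_ u≡i v≡n∸i) (ℕP.m+[n∸m]≡n (ℕP.≤′⇒≤ i≤n))

module _ {K L : Class} where

  Fiber-×C : ∀ n a c → Fiber (K ×C L) n a c ↔
    (Σ≤ n λ i → Σ≤ a λ p → Σ≤ c λ q → Fiber K i p q × Fiber L (n ℕ.∸ i) (a ℕ.∸ p) (c ℕ.∸ q))
  Fiber-×C n a c = ↔-trans (Σ-↔ ↔-refl (+≡-↔ ×-↔ +≡-↔ ×-↔ +≡-↔)) (mk↔ₛ′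
    (λ { ((x , y) , (i , i≤ , xi , yi) , (p , p≤ , xp , yp) , (q , q≤ , xq , yq)) →
         i , i≤ , p , p≤ , q , q≤ , (x , xi , xp , xq) , (y , yi , yp , yq) })
    (λ { (i , i≤ , p , p≤ , q , q≤ , (x , xi , xp , xq) , (y , yi , yp , yq)) →
         (x , y) , (i , i≤ , xi , yi) , (p , p≤ , xp , yp) , (q , q≤ , xq , yq) })
    (λ _ → refl) (λ _ → refl))

IsGFOf-⊛ : ∀ {F G K L} → IsGFOf F K → IsGFOf G L → IsGFOf (F ⊛ G) (K ×C L)
IsGFOf-⊛ F-K G-L n a c = HasCard-↔
  (HasCard-Σ≤ n λ i → HasCard-Σ≤ a λ p → HasCard-Σ≤ c λ q →
     HasCard-× (F-K i p q) (G-L (n ℕ.∸ i) (a ℕ.∸ p) (c ℕ.∸ q)))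
  (↔-sym (Fiber-×C n a c))

record _≅_ (K L : Class) : Set where
  field
    bijection : Carrier K ↔ Carrier L
    zdeg-≡  : ∀ x → zdeg K x ≡ zdeg L (Inverse.to bijection x)
    u0deg-≡ : ∀ x → u0deg K x ≡ u0deg L (Inverse.to bijection x)
    u1deg-≡ : ∀ x → u1deg K x ≡ u1deg L (Inverse.to bijection x)

≡-lhs-↔ : ∀ {A : Set} {x y z : A} → x ≡ y → (x ≡ z) ↔ (y ≡ z)
≡-lhs-↔ refl = ↔-refl

IsGFOf-≅ : ∀ {G K L} → K ≅ L → IsGFOf G K → IsGFOf G L
IsGFOf-≅ K≅L G-K n a c = HasCard-↔ (G-K n a c)
  (Σ-↔ bijection (≡-lhs-↔ (zdeg-≡ _) ×-↔ ≡-lhs-↔ (u0deg-≡ _) ×-↔ ≡-lhs-↔ (u1deg-≡ _)))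
  where open _≅_ K≅L

×C-rotate : ∀ {K L M} → ((K ×C L) ×C M) ≅ ((M ×C K) ×C L)
×C-rotate {K} {L} {M} = record
  { bijection = mk↔ₛ′ (λ ((x , y) , z) → (z , x) , y) (λ ((z , x) , y) → (x , y) , z) (λ _ → refl) (λ _ → refl)
  ; zdeg-≡  = λ ((x , y) , z) → rotate (zdeg K x) (zdeg L y) (zdeg M z)
  ; u0deg-≡ = λ ((x , y) , z) → rotate (u0deg K x) (u0deg L y) (u0deg M z)
  ; u1deg-≡ = λ ((x , y) , z) → rotate (u1deg K x) (u1deg L y) (u1deg M z)
  }
  where
  rotate : ∀ x y z → x ℕ.+ y ℕ.+ z ≡ z ℕ.+ x ℕ.+ y
  rotate = ℕSolver.solve-∀

labelIs labelAdjacentTo : ℤ → ℤ → Bool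
labelIs j ℓ = does (ℓ ≟ j)
labelAdjacentTo j ℓ = labelIs (j - 1ℤ) ℓ ∨ labelIs (j + 1ℤ) ℓ

labelIs-+ : ∀ j k x → labelIs j (x + k) ≡ labelIs (j - k) x
labelIs-+ j k x = does-⇔ (mk⇔ (λ e → trans (sym (+-k x k)) (cong (_- k) e))
                                (λ e → trans (cong (_+ k) e) (-k+k j k)))
                         (x + k ≟ j) (x ≟ j - k)
  where
  +-k : ∀ x k → x + k - k ≡ x
  +-k = solve-∀
  -k+k : ∀ j k → j - k + k ≡ j
  -k+k = solve-∀

labelAdjacentTo-+ : ∀ j k x → labelAdjacentTo j (x + k) ≡ labelAdjacentTo (j - k) x
labelAdjacentTo-+ j k x = cong₂ _∨_
  (trans (labelIs-+ (j - 1ℤ) k x) (cong (λ y → labelIs y x) (swap-1 j k)))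
  (trans (labelIs-+ (j + 1ℤ) k x) (cong (λ y → labelIs y x) (swap+1 j k)))
  where
  swap-1 : ∀ j k → j - 1ℤ - k ≡ j - k - 1ℤ
  swap-1 = solve-∀
  swap+1 : ∀ j k → j + 1ℤ - k ≡ j - k + 1ℤ
  swap+1 = solve-∀

labelIs-neg : ∀ j x → labelIs j x ≡ labelIs (- j) (- x)
labelIs-neg j x = does-⇔ (mk⇔ (cong (λ y → - y)) ℤP.neg-injective) (x ≟ j) (- x ≟ - j)

labelAdjacentTo-neg : ∀ j x → labelAdjacentTo j x ≡ labelAdjacentTo (- j) (- x)
labelAdjacentTo-neg j x = begin
  labelIs (j - 1ℤ) x ∨ labelIs (j + 1ℤ) x
    ≡⟨ cong₂ _∨_ (labelIs-neg (j - 1ℤ) x) (labelIs-neg (j + 1ℤ) x) ⟩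
  labelIs (- (j - 1ℤ)) (- x) ∨ labelIs (- (j + 1ℤ)) (- x)
    ≡⟨ cong₂ (λ u v → labelIs u (- x) ∨ labelIs v (- x)) (ℤP.neg-distrib-+ j (- 1ℤ)) (ℤP.neg-distrib-+ j 1ℤ) ⟩
  labelIs (- j + 1ℤ) (- x) ∨ labelIs (- j - 1ℤ) (- x)
    ≡⟨ BoolP.∨-comm (labelIs (- j + 1ℤ) (- x)) _ ⟩
  labelAdjacentTo (- j) (- x) ∎
  where open ≡-Reasoning

indicator : Bool → ℕ
indicator b = if b then 1 else 0

+-cong₄ : ∀ {a a′ b b′ c c′ d d′} → a ≡ a′ → b ≡ b′ → c ≡ c′ → d ≡ d′ →
  a ℕ.+ b ℕ.+ c ℕ.+ d ≡ a′ ℕ.+ b′ ℕ.+ c′ ℕ.+ d′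
+-cong₄ refl refl refl refl = refl

reverse3 : ∀ a x y z → a ℕ.+ x ℕ.+ y ℕ.+ z ≡ a ℕ.+ z ℕ.+ y ℕ.+ x
reverse3 = ℕSolver.solve-∀

cntIf-+ : ∀ {p q : ℤ → Bool} k → (∀ x → p (x + k) ≡ q x) → ∀ ℓ B → cntIf p (ℓ + k) B ≡ cntIf q ℓ B
cntIf-+ k p≡q ℓ leaf = refl
cntIf-+ {p} {q} k p≡q ℓ (node l c r) = +-cong₄
  (cong indicator (p≡q ℓ))
  (trans (cong (λ m → cntIf p m l) (swap (- 1ℤ) ℓ k)) (cntIf-+ k p≡q (ℓ - 1ℤ) l))
  (cntIf-+ k p≡q ℓ c)
  (trans (cong (λ m → cntIf p m r) (swap 1ℤ ℓ k)) (cntIf-+ k p≡q (ℓ + 1ℤ) r))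
  where
  swap : ∀ d ℓ k → ℓ + k + d ≡ ℓ + d + k
  swap = solve-∀

mirror : Tree → Tree
mirror leaf = leaf
mirror (node l c r) = node (mirror r) (mirror c) (mirror l)

mirror-involutive : ∀ B → mirror (mirror B) ≡ B
mirror-involutive leaf = refl
mirror-involutive (node l c r)
  rewrite mirror-involutive l | mirror-involutive c | mirror-involutive r = refl

size-mirror : ∀ B → size (mirror B) ≡ size B
size-mirror leaf = refl
size-mirror (node l c r) = begin
  1 ℕ.+ size (mirror r) ℕ.+ size (mirror c) ℕ.+ size (mirror l)
    ≡⟨ +-cong₄ refl (size-mirror r) (size-mirror c) (size-mirror l) ⟩
  1 ℕ.+ size r ℕ.+ size c ℕ.+ size l
    ≡⟨ reverse3 1 (size r) (size c) (size l) ⟩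
  1 ℕ.+ size l ℕ.+ size c ℕ.+ size r ∎
  where open ≡-Reasoning

cntIf-mirror : ∀ {p q : ℤ → Bool} → (∀ x → p x ≡ q (- x)) → ∀ ℓ B → cntIf p ℓ (mirror B) ≡ cntIf q (- ℓ) B
cntIf-mirror p≡q ℓ leaf = refl
cntIf-mirror {p} {q} p≡q ℓ (node l c r) = begin
  indicator (p ℓ) ℕ.+ cntIf p (ℓ - 1ℤ) (mirror r) ℕ.+ cntIf p ℓ (mirror c) ℕ.+ cntIf p (ℓ + 1ℤ) (mirror l)
    ≡⟨ +-cong₄ (cong indicator (p≡q ℓ))
               (cntIf-mirror p≡q (ℓ - 1ℤ) r) (cntIf-mirror p≡q ℓ c) (cntIf-mirror p≡q (ℓ + 1ℤ) l) ⟩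
  indicator (q (- ℓ)) ℕ.+ cntIf q (- (ℓ - 1ℤ)) r ℕ.+ cntIf q (- ℓ) c ℕ.+ cntIf q (- (ℓ + 1ℤ)) l
    ≡⟨ cong₂ (λ u v → indicator (q (- ℓ)) ℕ.+ cntIf q u r ℕ.+ cntIf q (- ℓ) c ℕ.+ cntIf q v l)
             (ℤP.neg-distrib-+ ℓ (- 1ℤ)) (ℤP.neg-distrib-+ ℓ 1ℤ) ⟩
  indicator (q (- ℓ)) ℕ.+ cntIf q (- ℓ + 1ℤ) r ℕ.+ cntIf q (- ℓ) c ℕ.+ cntIf q (- ℓ - 1ℤ) l
    ≡⟨ reverse3 _ (cntIf q (- ℓ + 1ℤ) r) (cntIf q (- ℓ) c) (cntIf q (- ℓ - 1ℤ) l) ⟩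
  cntIf q (- ℓ) (node l c r) ∎
  where open ≡-Reasoning

A-node : ∀ j l c r →
  A j (node l c r) ≡ indicator (labelIs j 0ℤ) ℕ.+ A (j + 1ℤ) l ℕ.+ A j c ℕ.+ A (j - 1ℤ) r
A-node j l c r = cong₂ (λ x y → indicator (labelIs j 0ℤ) ℕ.+ x ℕ.+ A j c ℕ.+ y)
  (cntIf-+ {labelIs j} (- 1ℤ) (labelIs-+ j (- 1ℤ)) 0ℤ l)
  (cntIf-+ {labelIs j} 1ℤ (labelIs-+ j 1ℤ) 0ℤ r)

C-node : ∀ j l c r →
  C j (node l c r) ≡ indicator (labelAdjacentTo j 0ℤ) ℕ.+ C (j + 1ℤ) l ℕ.+ C j c ℕ.+ C (j - 1ℤ) r
C-node j l c r = cong₂ (λ x y → indicator (labelAdjacentTo j 0ℤ) ℕ.+ x ℕ.+ C j c ℕ.+ y)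
  (cntIf-+ {labelAdjacentTo j} (- 1ℤ) (labelAdjacentTo-+ j (- 1ℤ)) 0ℤ l)
  (cntIf-+ {labelAdjacentTo j} 1ℤ (labelAdjacentTo-+ j 1ℤ) 0ℤ r)

A-mirror : ∀ j B → A j (mirror B) ≡ A (- j) B
A-mirror j = cntIf-mirror (labelIs-neg j) 0ℤ

C-mirror : ∀ j B → C j (mirror B) ≡ C (- j) B
C-mirror j = cntIf-mirror (labelAdjacentTo-neg j) 0ℤ

trees : ℤ → Class
trees j = record { Carrier = Tree ; zdeg = size ; u0deg = A j ; u1deg = C j }

mirror-≅ : ∀ j → trees (- j) ≅ trees j
mirror-≅ j = record
  { bijection = mk↔ₛ′ mirror mirror mirror-involutive mirror-involutive
  ; zdeg-≡  = λ B → sym (size-mirror B)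
  ; u0deg-≡ = λ B → sym (A-mirror j B)
  ; u1deg-≡ = λ B → sym (C-mirror j B)
  }

data Height≤ : ℕ → Tree → Set where
  leaf : ∀ {h} → Height≤ h leaf
  node : ∀ {h l c r} → Height≤ h l → Height≤ h c → Height≤ h r → Height≤ (suc h) (node l c r)

Height≤-irrelevant : ∀ {h B} → Irrelevant (Height≤ h B)
Height≤-irrelevant leaf leaf = refl
Height≤-irrelevant (node l c r) (node l′ c′ r′)
  rewrite Height≤-irrelevant l l′ | Height≤-irrelevant c c′ | Height≤-irrelevant r r′ = refl

Height≤-mono : ∀ {h h′ B} → h ℕ.≤ h′ → Height≤ h B → Height≤ h′ B
Height≤-mono _ leaf = leaf
Height≤-mono (s≤s h≤h′) (node l c r) =
  node (Height≤-mono h≤h′ l) (Height≤-mono h≤h′ c) (Height≤-mono h≤h′ r)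

Height≤-size : ∀ B → Height≤ (size B) B
Height≤-size leaf = leaf
Height≤-size (node l c r) = node
  (Height≤-mono (ℕP.≤-trans (ℕP.m≤m+n (size l) (size c)) (ℕP.m≤m+n _ (size r))) (Height≤-size l))
  (Height≤-mono (ℕP.≤-trans (ℕP.m≤n+m (size c) (size l)) (ℕP.m≤m+n _ (size r))) (Height≤-size c))
  (Height≤-mono (ℕP.m≤n+m (size r) _) (Height≤-size r))

Finite-Height≤ : ∀ h → Finite (Σ Tree (Height≤ h))
Finite-Height≤ zero = 1ℤ , HasCard-1 (leaf , leaf) (λ { (leaf , leaf) → refl })
Finite-Height≤ (suc h) = Finite-↔
  (Finite-⊎ Finite-⊤ (Finite-× (Finite-× (Finite-Height≤ h) (Finite-Height≤ h)) (Finite-Height≤ h)))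
  (mk↔ₛ′ build split (λ { (leaf , leaf) → refl ; (node _ _ _ , node _ _ _) → refl })
                     (λ { (inj₁ _) → refl ; (inj₂ _) → refl }))
  where
  Bounded = Σ Tree (Height≤ h)
  build : ⊤ ⊎ (Bounded × Bounded) × Bounded → Σ Tree (Height≤ (suc h))
  build (inj₁ _) = leaf , leaf
  build (inj₂ (((l , hl) , (c , hc)) , (r , hr))) = node l c r , node hl hc hr
  split : Σ Tree (Height≤ (suc h)) → ⊤ ⊎ (Bounded × Bounded) × Bounded
  split (leaf , _) = inj₁ tt
  split (node l c r , node hl hc hr) = inj₂ (((l , hl) , (c , hc)) , (r , hr))

Finite-Fiber-trees : ∀ j n a c → Finite (Fiber (trees j) n a c)
Finite-Fiber-trees j n a c = Finite-↔
  (Finite-Σ (Finite-Height≤ n) λ (B , _) →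
     Finite-prop (size B ℕ.≟ n ×-dec A j B ℕ.≟ a ×-dec C j B ℕ.≟ c)
                 (×-irrelevant ℕP.≡-irrelevant (×-irrelevant ℕP.≡-irrelevant ℕP.≡-irrelevant)))
  (mk↔ₛ′ (λ ((B , _) , e) → B , e)
         (λ (B , e) → (B , subst (λ h → Height≤ h B) (proj₁ e) (Height≤-size B)) , e)
         (λ _ → refl)
         (λ ((B , h) , e) → cong (λ h → (B , h) , e) (Height≤-irrelevant _ _)))

S : ℤ → Series
S j n a c = proj₁ (Finite-Fiber-trees j n a c)

S-isGF : ∀ j → IsGF j (S j)
S-isGF j n a c = proj₂ (Finite-Fiber-trees j n a c)

S-symmetric : ∀ j → S j ≋ S (- j)
S-symmetric j = IsGFOf-unique (S-isGF j) (IsGFOf-≅ (mirror-≅ j) (S-isGF (- j)))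

-- The factors are the right, center and left subtree, matching S_{j-1} S_j S_{j+1}.
children : ℤ → Class
children j = (trees (j - 1ℤ) ×C trees j) ×C trees (j + 1ℤ)

Node : ℤ → Class
Node j = 𝟙C ⊎C shift 1 (indicator (labelIs j 0ℤ)) (indicator (labelAdjacentTo j 0ℤ)) (children j)

root-decomposition : ∀ j → Node j ≅ trees j
root-decomposition j = record
  { bijection = mk↔ₛ′ build split (λ { leaf → refl ; (node _ _ _) → refl })
                                  (λ { (inj₁ _) → refl ; (inj₂ _) → refl })
  ; zdeg-≡  = λ { (inj₁ _) → refl
                ; (inj₂ ((r , c) , l)) → reverse 1 (size r) (size c) (size l) }
  ; u0deg-≡ = λ { (inj₁ _) → refl
                ; (inj₂ ((r , c) , l)) →
                    trans (reverse _ (A (j - 1ℤ) r) (A j c) (A (j + 1ℤ) l)) (sym (A-node j l c r)) }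
  ; u1deg-≡ = λ { (inj₁ _) → refl
                ; (inj₂ ((r , c) , l)) →
                    trans (reverse _ (C (j - 1ℤ) r) (C j c) (C (j + 1ℤ) l)) (sym (C-node j l c r)) }
  }
  where
  build : ⊤ ⊎ (Tree × Tree) × Tree → Tree
  build (inj₁ _) = leaf
  build (inj₂ ((r , c) , l)) = node l c r
  split : Tree → ⊤ ⊎ (Tree × Tree) × Tree
  split leaf = inj₁ tt
  split (node l c r) = inj₂ ((r , c) , l)
  reverse : ∀ a x y z → a ℕ.+ (x ℕ.+ y ℕ.+ z) ≡ a ℕ.+ z ℕ.+ y ℕ.+ x
  reverse = ℕSolver.solve-∀

-- For concrete j the indicators in Node j compute, and shift 1 a c K is definitionally
-- shift 0 a c (shift 1 0 0 K); so the cases below are built from IsGFOf-z, IsGFOf-u0 and IsGFOf-u1.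
S-by-root : ∀ {j G} → IsGFOf G (Node j) → S j ≋ G
S-by-root {j} G-Node = IsGFOf-unique (S-isGF j) (IsGFOf-≅ (root-decomposition j) G-Node)

IsGFOf-children : ∀ j → IsGFOf (S (j - 1ℤ) ⊛ S j ⊛ S (j + 1ℤ)) (children j)
IsGFOf-children j = IsGFOf-⊛ (IsGFOf-⊛ (S-isGF (j - 1ℤ)) (S-isGF j)) (S-isGF (j + 1ℤ))

S-recurrence : ∀ j → + 2 ≤ j → S j ≋ 𝟙 ⊕ z· (S (j - 1ℤ) ⊛ S j ⊛ S (j + 1ℤ))
S-recurrence (+ 0) (+≤+ ())
S-recurrence (+ 1) (+≤+ (s≤s ()))
S-recurrence (+ suc (suc k)) _ = S-by-root (IsGFOf-⊕ IsGFOf-𝟙 (IsGFOf-z (IsGFOf-children (+ suc (suc k)))))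

S-recurrence₁ : S (+ 1) ≋ 𝟙 ⊕ u1· (z· (S (+ 0) ⊛ S (+ 1) ⊛ S (+ 2)))
S-recurrence₁ = S-by-root (IsGFOf-⊕ IsGFOf-𝟙 (IsGFOf-u1 (IsGFOf-z (IsGFOf-children (+ 1)))))

S-recurrence₀ : S (+ 0) ≋ 𝟙 ⊕ u0· (z· (S (- (+ 1)) ⊛ S (+ 0) ⊛ S (+ 1)))
S-recurrence₀ = S-by-root (IsGFOf-⊕ IsGFOf-𝟙 (IsGFOf-u0 (IsGFOf-z (IsGFOf-children (+ 0)))))

S-recurrence₀′ : S (+ 0) ≋ 𝟙 ⊕ u0· (z· (S (+ 0) ⊛ S (+ 1) ⊛ S (+ 1)))
S-recurrence₀′ = S-by-root (IsGFOf-⊕ IsGFOf-𝟙 (IsGFOf-u0 (IsGFOf-z (IsGFOf-≅ rotate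
  (IsGFOf-⊛ (IsGFOf-⊛ (S-isGF (+ 0)) (S-isGF (+ 1))) S₁-counts-trees₋₁)))))
  where
  rotate : ((trees (+ 0) ×C trees (+ 1)) ×C trees (- (+ 1))) ≅ children (+ 0)
  rotate = ×C-rotate {trees (+ 0)} {trees (+ 1)} {trees (- (+ 1))}
  S₁-counts-trees₋₁ : IsGFOf (S (+ 1)) (trees (- (+ 1)))
  S₁-counts-trees₋₁ = IsGFOf-≅ (mirror-≅ (- (+ 1))) (S-isGF (+ 1))

AgreeBelow : ℕ → Series → Series → Set
AgreeBelow m F G = ∀ n → n ℕ.< m → ∀ a c → F n a c ≡ G n a c

module _ {m : ℕ} where

  AgreeBelow-≋ : ∀ {F F′ G G′} → F ≋ F′ → G ≋ G′ → AgreeBelow m F′ G′ → AgreeBelow m F G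
  AgreeBelow-≋ F≋F′ G≋G′ agree n n<m a c =
    trans (F≋F′ n a c) (trans (agree n n<m a c) (sym (G≋G′ n a c)))

  𝟙⊕-agree : ∀ {F G} → AgreeBelow m F G → AgreeBelow m (𝟙 ⊕ F) (𝟙 ⊕ G)
  𝟙⊕-agree agree n n<m a c = cong (λ x → 𝟙 n a c + x) (agree n n<m a c)

  ⊛-agree : ∀ {F F′ G G′} → AgreeBelow m F F′ → AgreeBelow m G G′ → AgreeBelow m (F ⊛ G) (F′ ⊛ G′)
  ⊛-agree agreeF agreeG n n<m a c =
    sumTo-cong n λ i i≤n → sumTo-cong a λ p _ → sumTo-cong c λ q _ → cong₂ ℤ._*_
      (agreeF i (ℕP.≤-<-trans i≤n n<m) p q)
      (agreeG (n ℕ.∸ i) (ℕP.≤-<-trans (ℕP.m∸n≤m n i) n<m) (a ℕ.∸ p) (c ℕ.∸ q))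
    where
    sumTo-cong : ∀ n {f g : ℕ → ℤ} → (∀ i → i ℕ.≤ n → f i ≡ g i) → sumTo n f ≡ sumTo n g
    sumTo-cong zero f≡g = f≡g 0 z≤n
    sumTo-cong (suc n) f≡g =
      cong₂ _+_ (sumTo-cong n (λ i i≤n → f≡g i (ℕP.m≤n⇒m≤1+n i≤n))) (f≡g (suc n) ℕP.≤-refl)

  z·-agree : ∀ {F G} → AgreeBelow m F G → AgreeBelow (suc m) (z· F) (z· G)
  z·-agree agree zero _ a c = refl
  z·-agree agree (suc n) (s≤s n<m) a c = agree n n<m a c

  u0·-agree : ∀ {F G} → AgreeBelow m F G → AgreeBelow m (u0· F) (u0· G)
  u0·-agree agree n n<m zero c = refl
  u0·-agree agree n n<m (suc a) c = agree n n<m a c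

  u1·-agree : ∀ {F G} → AgreeBelow m F G → AgreeBelow m (u1· F) (u1· G)
  u1·-agree agree n n<m a zero = refl
  u1·-agree agree n n<m a (suc c) = agree n n<m a c

SolvesSystem-unique : ∀ {T T′} → SolvesSystem T → SolvesSystem T′ → ∀ k → T k ≋ T′ k
SolvesSystem-unique {T} {T′} (eqs , eq₁ , eq₀) (eqs′ , eq₁′ , eq₀′) k n =
  agree (suc n) k n (ℕP.n<1+n n)
  where
  agree : ∀ m k → AgreeBelow m (T k) (T′ k)
  agree zero k n ()
  agree (suc m) 0 = AgreeBelow-≋ eq₀ eq₀′ (𝟙⊕-agree (u0·-agree (z·-agree
    (⊛-agree (⊛-agree (agree m 0) (agree m 1)) (agree m 1)))))
  agree (suc m) 1 = AgreeBelow-≋ eq₁ eq₁′ (𝟙⊕-agree (u1·-agree (z·-agree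
    (⊛-agree (⊛-agree (agree m 0) (agree m 1)) (agree m 2)))))
  agree (suc m) (suc (suc k)) = AgreeBelow-≋ (eqs k) (eqs′ k) (𝟙⊕-agree (z·-agree
    (⊛-agree (⊛-agree (agree m (suc k)) (agree m (suc (suc k)))) (agree m (suc (suc (suc k)))))))

S-solves : SolvesSystem (λ k → S (+ k))
S-solves = recurrence , S-recurrence₁ , S-recurrence₀′
  where
  recurrence : ∀ k → S (+ suc (suc k)) ≋ 𝟙 ⊕ z· (S (+ suc k) ⊛ S (+ suc (suc k)) ⊛ S (+ suc (suc (suc k))))
  -- + suc (suc k) + 1ℤ computes to + (suc (suc k) ℕ.+ 1), which is stuck on k.
  recurrence k =
    subst (λ m → S (+ suc (suc k)) ≋ 𝟙 ⊕ z· (S (+ suc k) ⊛ S (+ suc (suc k)) ⊛ S (+ m)))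
          (ℕP.+-comm (suc (suc k)) 1)
          (S-recurrence (+ suc (suc k)) (+≤+ (s≤s (s≤s z≤n))))

lemma3 : Σ (ℤ → Series) λ S →
    (∀ j → IsGF j (S j)) ×
    (∀ j → S j ≋ S (- j)) ×
    (∀ j → + 2 ≤ j → S j ≋ 𝟙 ⊕ z· (S (j - 1ℤ) ⊛ S j ⊛ S (j + 1ℤ))) ×
    (S (+ 1) ≋ 𝟙 ⊕ u1· (z· (S (+ 0) ⊛ S (+ 1) ⊛ S (+ 2)))) ×
    (S (+ 0) ≋ 𝟙 ⊕ u0· (z· (S (- (+ 1)) ⊛ S (+ 0) ⊛ S (+ 1)))) ×
    (S (+ 0) ≋ 𝟙 ⊕ u0· (z· (S (+ 0) ⊛ S (+ 1) ⊛ S (+ 1)))) ×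
    (∀ (T : ℕ → Series) → SolvesSystem T → ∀ k → T k ≋ S (+ k))
lemma3 = S , S-isGF , S-symmetric , S-recurrence , S-recurrence₁ , S-recurrence₀ , S-recurrence₀′
       , λ T T-solves → SolvesSystem-unique T-solves S-solves
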